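{- Let $p$ be a prime, $\mathbf{A}\in\mathbb{F}_p^{m\times n}$, $\mathbf{b}\in\mathbb{F}_p^m$ and $\mathbf{d}\in\mathbb{F}_p^n$. If $\mathbf{A}\mathbf{d}=\mathbf{0}$, then $\Delta_{\mathbf{d}}\in\mathrm{Sym}(F(\mathbf{A},\mathbf{b}))$.
   Context: Variables $\xi_{i,k}$ ($i\in[1,n]$, $k\in\mathbb{F}_p$). $\Delta_{\mathbf{d}}$ is the renaming $\xi_{i,k}\mapsto\xi_{i,k+\mathbf{d}_i}$ (extended to literals, clauses, formulas). $\mathrm{Sym}(F)$ is the set of renamings $\sigma$ with $\sigma(F)=F$. $\mathrm{supp}(\mathbf{r})=\{i:r_i\neq0\}$; for a row $\mathbf{a}$ and $b\in\mathbb{F}_p$: $P(\mathbf{a},b)=\{\mathbf{x}:\mathbf{a}\cdot\mathbf{x}\neq b,\ \mathrm{supp}(\mathbf{x})\subseteq\mathrm{supp}(\mathbf{a})\}$, $C_{\mathbf{a}}(\mathbf{x})=\bigvee_{i\in\mathrm{supp}(\mathbf{a})}\overline{\xi_{i,\mathbf{x}_i}}$, $F(\mathbf{a},b)=\bigwedge_{\mathbf{x}\in P(\mathbf{a},b)}C_{\mathbf{a}}(\mathbf{x})$; $F(\mathbf{A},\mathbf{b})=\bigwedge_{i=1}^mF(\mathbf{A}_{i,*},\mathbf{b}_i)$. -}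

module Defs where

open import Data.Nat as ℕ using (ℕ; zero; suc; NonZero)
open import Data.Nat.DivMod using (_mod_)
open import Data.Fin as Fin using (Fin; toℕ; _≟_)
open import Data.Fin.Properties using (all?)
open import Data.Product using (_×_; _,_; Σ; ∃)
open import Data.List using (List; []; _∷_; map; filter; concatMap; foldr)
open import Data.List.Membership.Propositional using (_∈_)
open import Data.Vec.Functional as VF using (Vector)
open import Function.Bundles using (_⇔_)
open import Function.Definitions using (Bijective)
open import Relation.Binary.PropositionalEquality using (_≡_)
open import Relation.Nullary using (¬_)
open import Relation.Nullary.Decidable using (¬?; _×-dec_; _→-dec_)

-- Everything is parameterised by the modulus p (assumed nonzero; in the
-- statement p is prime).  𝔽p is represented by Fin p with arithmetic mod p.
module FpCNF (p : ℕ) .{{_ : NonZero p}} where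

  𝔽 : Set
  𝔽 = Fin p

  0𝔽 : 𝔽
  0𝔽 = 0 mod p

  _+𝔽_ : 𝔽 → 𝔽 → 𝔽
  a +𝔽 b = (toℕ a ℕ.+ toℕ b) mod p

  _*𝔽_ : 𝔽 → 𝔽 → 𝔽
  a *𝔽 b = (toℕ a ℕ.* toℕ b) mod p

  dot : ∀ {n} → Vector 𝔽 n → Vector 𝔽 n → 𝔽
  dot {zero}  a x = 0𝔽
  dot {suc n} a x = (VF.head a *𝔽 VF.head x) +𝔽 dot (VF.tail a) (VF.tail x)

  matVec : ∀ {m n} → (Fin m → Fin n → 𝔽) → Vector 𝔽 n → Vector 𝔽 m
  matVec A x j = dot (A j) x

  -- Variables ξ_{i,k} with i ∈ [1,n] (as Fin n) and k ∈ 𝔽p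
  Var : ℕ → Set
  Var n = Fin n × 𝔽

  data Lit (n : ℕ) : Set where
    pos : Var n → Lit n
    neg : Var n → Lit n

  -- A clause is a disjunction (set) of literals, a CNF formula a
  -- conjunction (set) of clauses; both represented by finite lists and
  -- compared as sets (see _≈F_ below).
  Clause : ℕ → Set
  Clause n = List (Lit n)

  CNF : ℕ → Set
  CNF n = List (Clause n)

  Renaming : ℕ → Set
  Renaming n = Var n → Var n

  renLit : ∀ {n} → Renaming n → Lit n → Lit n
  renLit σ (pos v) = pos (σ v)
  renLit σ (neg v) = neg (σ v)

  renClause : ∀ {n} → Renaming n → Clause n → Clause n
  renClause σ C = map (renLit σ) C

  renCNF : ∀ {n} → Renaming n → CNF n → CNF n
  renCNF σ F = map (renClause σ) F

  Δ : ∀ {n} → Vector 𝔽 n → Renaming n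
  Δ d (i , k) = (i , k +𝔽 d i)

  _≈C_ : ∀ {n} → Clause n → Clause n → Set
  C ≈C D = ∀ l → (l ∈ C) ⇔ (l ∈ D)

  _≈F_ : ∀ {n} → CNF n → CNF n → Set
  F ≈F G = (∀ C → C ∈ F → ∃ λ D → D ∈ G × C ≈C D)
         × (∀ D → D ∈ G → ∃ λ C → C ∈ F × C ≈C D)

  _∈Sym_ : ∀ {n} → Renaming n → CNF n → Set
  σ ∈Sym F = Bijective _≡_ _≡_ σ × (renCNF σ F ≈F F)

  allVecs : (n : ℕ) → List (Vector 𝔽 n)
  allVecs zero    = (λ ()) ∷ []
  allVecs (suc n) = concatMap (λ k → map (k VF.∷_) (allVecs n)) (Data.List.allFin p)
    where import Data.List

  _⊆supp_ : ∀ {n} → Vector 𝔽 n → Vector 𝔽 n → Set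
  x ⊆supp a = ∀ i → ¬ (x i ≡ 0𝔽) → ¬ (a i ≡ 0𝔽)

  P : ∀ {n} → Vector 𝔽 n → 𝔽 → List (Vector 𝔽 n)
  P {n} a b = filter (λ x → ¬? (dot a x ≟ b)
                        ×-dec all? (λ i → ¬? (x i ≟ 0𝔽) →-dec ¬? (a i ≟ 0𝔽)))
                     (allVecs n)

  Ca : ∀ {n} → Vector 𝔽 n → Vector 𝔽 n → Clause n
  Ca {n} a x = map (λ i → neg (i , x i))
                   (filter (λ i → ¬? (a i ≟ 0𝔽)) (Data.List.allFin n))
    where import Data.List

  Fab : ∀ {n} → Vector 𝔽 n → 𝔽 → CNF n
  Fab a b = map (Ca a) (P a b)

  FAb : ∀ {m n} → (Fin m → Fin n → 𝔽) → Vector 𝔽 m → CNF n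
  FAb {m} A b = concatMap (λ j → Fab (A j) (b j)) (Data.List.allFin m)
    where import Data.List

-- Treat A x = b row by row. For a row a with a · d = 0, the clauses of
-- F(a, b) are the C_a(x) with x ∈ P(a, b), and Δ_d sends C_a(x) to
-- C_a(x + d), which only reads x + d on supp(a). Restricting x + d to
-- supp(a) keeps a · (x + d) = a · x ≠ b, so it lands in P(a, b) again;
-- subtracting d shows every clause of F(a, b) is hit. Hence Δ_d permutes
-- the clauses of each F(a, b), and so of their conjunction F(A, b).
module Submission where

open import Defs
open import Data.Nat using (ℕ)
open import Data.Nat.Primality using (Prime; prime⇒nonZero)
open import Data.Fin using (Fin)
open import Relation.Binary.PropositionalEquality using (_≡_)

open import Data.Bool using (if_then_else_)
open import Data.Empty using (⊥-elim)
open import Data.Fin using (zero; suc; toℕ; _≟_)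
open import Data.Fin.Properties using (toℕ-fromℕ<; toℕ-injective; toℕ<n)
open import Data.List using (List; map; concatMap; allFin)
open import Data.List.Membership.Propositional using (_∈_; find; lose)
open import Data.List.Membership.Propositional.Properties
  using (∈-map⁺; ∈-map⁻; ∈-filter⁺; ∈-filter⁻; ∈-concatMap⁺; ∈-concatMap⁻; ∈-allFin)
open import Data.List.Properties using (map-∘; map-cong-local; map-concatMap)
open import Data.List.Relation.Unary.All using (tabulate)
open import Data.List.Relation.Unary.Any using (here)
open import Data.Nat using (zero; suc; NonZero; _+_; _*_; _∸_; _%_; >-nonZero⁻¹)
open import Data.Nat.DivMod
  using (_mod_; %-distribˡ-+; %-distribˡ-*; m%n%n≡m%n; m%n<n; m<n⇒m%n≡m; [m+n]%n≡m%n)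
open import Data.Nat.Properties
  using (+-assoc; +-identityʳ; *-distribˡ-+; m∸n+n≡m; m+[n∸m]≡n; <⇒≤; +-commutativeSemigroup)
open import Algebra.Properties.CommutativeSemigroup +-commutativeSemigroup using (interchange)
open import Data.Product using (_×_; _,_; ∃; proj₁; proj₂)
open import Data.Vec.Functional using (Vector; head; tail; _∷_)
open import Function.Bundles using (mk⇔)
open import Function.Definitions using (Bijective)
open import Relation.Binary.PropositionalEquality
  using (refl; sym; trans; cong; cong₂; subst; _≗_; module ≡-Reasoning)
open import Relation.Nullary using (¬_; yes; no; does)
open import Relation.Nullary.Decidable using (¬?)

module ShiftSymmetry (p : ℕ) .{{_ : NonZero p}} where
  open FpCNF p
  open ≡-Reasoning

  toℕ-mod : ∀ m → toℕ (m mod p) ≡ m % p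
  toℕ-mod m = toℕ-fromℕ< (m%n<n m p)

  toℕ-%-id : (x : 𝔽) → toℕ x % p ≡ toℕ x
  toℕ-%-id x = m<n⇒m%n≡m (toℕ<n x)

  toℕ-0𝔽 : toℕ 0𝔽 ≡ 0
  toℕ-0𝔽 = trans (toℕ-mod 0) (m<n⇒m%n≡m (>-nonZero⁻¹ p))

  %-cong-+ : ∀ {u u′ v v′} → u % p ≡ u′ % p → v % p ≡ v′ % p →
             (u + v) % p ≡ (u′ + v′) % p
  %-cong-+ {u} {u′} {v} {v′} eu ev = begin
    (u + v) % p              ≡⟨ %-distribˡ-+ u v p ⟩
    (u % p + v % p) % p      ≡⟨ cong₂ (λ s t → (s + t) % p) eu ev ⟩
    (u′ % p + v′ % p) % p    ≡⟨ %-distribˡ-+ u′ v′ p ⟨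
    (u′ + v′) % p            ∎

  %-cong-*ˡ : ∀ u {v v′} → v % p ≡ v′ % p → (u * v) % p ≡ (u * v′) % p
  %-cong-*ˡ u {v} {v′} ev = begin
    (u * v) % p              ≡⟨ %-distribˡ-* u v p ⟩
    (u % p * (v % p)) % p    ≡⟨ cong (λ t → (u % p * t) % p) ev ⟩
    (u % p * (v′ % p)) % p   ≡⟨ %-distribˡ-* u v′ p ⟨
    (u * v′) % p             ∎

  +𝔽-identityʳ : (x : 𝔽) → x +𝔽 0𝔽 ≡ x
  +𝔽-identityʳ x = toℕ-injective (begin
    toℕ (x +𝔽 0𝔽)            ≡⟨ toℕ-mod _ ⟩
    (toℕ x + toℕ 0𝔽) % p     ≡⟨ cong (λ t → (toℕ x + t) % p) toℕ-0𝔽 ⟩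
    (toℕ x + 0) % p          ≡⟨ cong (_% p) (+-identityʳ (toℕ x)) ⟩
    toℕ x % p                ≡⟨ toℕ-%-id x ⟩
    toℕ x                    ∎)

  -- truncated subtraction is safe here: toℕ d < p
  _-𝔽_ : 𝔽 → 𝔽 → 𝔽
  x -𝔽 d = (toℕ x + (p ∸ toℕ d)) mod p

  [[x+e]%p+f]%p≡x : (x : 𝔽) {e f : ℕ} → e + f ≡ p → ((toℕ x + e) % p + f) % p ≡ toℕ x
  [[x+e]%p+f]%p≡x x {e} {f} e+f≡p = begin
    ((toℕ x + e) % p + f) % p   ≡⟨ %-cong-+ (m%n%n≡m%n (toℕ x + e) p) refl ⟩
    ((toℕ x + e) + f) % p       ≡⟨ cong (_% p) (+-assoc (toℕ x) e f) ⟩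
    (toℕ x + (e + f)) % p       ≡⟨ cong (λ t → (toℕ x + t) % p) e+f≡p ⟩
    (toℕ x + p) % p             ≡⟨ [m+n]%n≡m%n (toℕ x) p ⟩
    toℕ x % p                   ≡⟨ toℕ-%-id x ⟩
    toℕ x                       ∎

  -𝔽-+𝔽-cancel : (x d : 𝔽) → (x -𝔽 d) +𝔽 d ≡ x
  -𝔽-+𝔽-cancel x d = toℕ-injective (trans (toℕ-mod _) (trans
    (cong (λ t → (t + toℕ d) % p) (toℕ-mod _))
    ([[x+e]%p+f]%p≡x x (m∸n+n≡m (<⇒≤ (toℕ<n d))))))

  +𝔽--𝔽-cancel : (x d : 𝔽) → (x +𝔽 d) -𝔽 d ≡ x
  +𝔽--𝔽-cancel x d = toℕ-injective (trans (toℕ-mod _) (trans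
    (cong (λ t → (t + (p ∸ toℕ d)) % p) (toℕ-mod _))
    ([[x+e]%p+f]%p≡x x (m+[n∸m]≡n (<⇒≤ (toℕ<n d))))))

  module _ {n : ℕ} where

    _⊕_ : Vector 𝔽 n → Vector 𝔽 n → Vector 𝔽 n
    (x ⊕ y) i = x i +𝔽 y i

    _⊖_ : Vector 𝔽 n → Vector 𝔽 n → Vector 𝔽 n
    (x ⊖ y) i = x i -𝔽 y i

    restrictTo : Vector 𝔽 n → Vector 𝔽 n → Vector 𝔽 n
    restrictTo a x i = if does (a i ≟ 0𝔽) then 0𝔽 else x i

    restrictTo-outside : ∀ a x i → a i ≡ 0𝔽 → restrictTo a x i ≡ 0𝔽
    restrictTo-outside a x i ai≡0 with a i ≟ 0𝔽
    ... | yes _    = refl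
    ... | no  ai≢0 = ⊥-elim (ai≢0 ai≡0)

    restrictTo-inside : ∀ a x i → ¬ a i ≡ 0𝔽 → restrictTo a x i ≡ x i
    restrictTo-inside a x i ai≢0 with a i ≟ 0𝔽
    ... | yes ai≡0 = ⊥-elim (ai≢0 ai≡0)
    ... | no  _    = refl

    restrictTo-⊆supp : ∀ a x → restrictTo a x ⊆supp a
    restrictTo-⊆supp a x i rx≢0 ai≡0 = rx≢0 (restrictTo-outside a x i ai≡0)

    ⊆supp-outside : ∀ {a : Vector 𝔽 n} x i → x ⊆supp a → a i ≡ 0𝔽 → x i ≡ 0𝔽
    ⊆supp-outside x i x⊆a ai≡0 with x i ≟ 0𝔽
    ... | yes xi≡0 = xi≡0
    ... | no  xi≢0 = ⊥-elim (x⊆a i xi≢0 ai≡0)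

    AgreeOnSupp : Vector 𝔽 n → Vector 𝔽 n → Vector 𝔽 n → Set
    AgreeOnSupp a x y = ∀ i → ¬ a i ≡ 0𝔽 → x i ≡ y i

    restrictTo-agree : ∀ a {u x} → x ⊆supp a → AgreeOnSupp a u x → restrictTo a u ≗ x
    restrictTo-agree a {x = x} x⊆a u≐x i with a i ≟ 0𝔽
    ... | yes ai≡0 = sym (⊆supp-outside x i x⊆a ai≡0)
    ... | no  ai≢0 = u≐x i ai≢0

  dotℕ : ∀ {n} → Vector 𝔽 n → Vector 𝔽 n → ℕ
  dotℕ {zero}  a x = 0
  dotℕ {suc n} a x = toℕ (head a) * toℕ (head x) + dotℕ (tail a) (tail x)

  toℕ-dot : ∀ {n} (a x : Vector 𝔽 n) → toℕ (dot a x) ≡ dotℕ a x % p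
  toℕ-dot {zero}  a x = toℕ-mod 0
  toℕ-dot {suc n} a x =
    trans (toℕ-mod _) (%-cong-+ (reduced (toℕ-mod _)) (reduced (toℕ-dot (tail a) (tail x))))
    where
    reduced : ∀ {u v} → u ≡ v % p → u % p ≡ v % p
    reduced {v = v} refl = m%n%n≡m%n v p

  dotℕ-restrictTo : ∀ {n} (a x : Vector 𝔽 n) → dotℕ a (restrictTo a x) ≡ dotℕ a x
  dotℕ-restrictTo {zero}  a x = refl
  dotℕ-restrictTo {suc n} a x =
    cong₂ _+_ head-term (dotℕ-restrictTo (tail a) (tail x))
    where
    head-term : toℕ (head a) * toℕ (restrictTo a x zero) ≡ toℕ (head a) * toℕ (head x)
    head-term with head a ≟ 0𝔽
    ... | yes a₀≡0 rewrite a₀≡0 | toℕ-0𝔽 = refl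
    ... | no  _    = refl

  dotℕ-⊕ : ∀ {n} (a x y : Vector 𝔽 n) →
           dotℕ a (x ⊕ y) % p ≡ (dotℕ a x + dotℕ a y) % p
  dotℕ-⊕ {zero}  a x y = refl
  dotℕ-⊕ {suc n} a x y = begin
    (a₀ * toℕ (x₀ +𝔽 y₀) + dotℕ a′ (x′ ⊕ y′)) % p
      ≡⟨ %-cong-+ head-term (dotℕ-⊕ a′ x′ y′) ⟩
    ((a₀ * toℕ x₀ + a₀ * toℕ y₀) + (dotℕ a′ x′ + dotℕ a′ y′)) % p
      ≡⟨ cong (_% p) (interchange (a₀ * toℕ x₀) _ _ _) ⟩
    ((a₀ * toℕ x₀ + dotℕ a′ x′) + (a₀ * toℕ y₀ + dotℕ a′ y′)) % p ∎
    where
    a₀ = toℕ (head a); x₀ = head x; y₀ = head y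
    a′ = tail a; x′ = tail x; y′ = tail y
    head-term : (a₀ * toℕ (x₀ +𝔽 y₀)) % p ≡ (a₀ * toℕ x₀ + a₀ * toℕ y₀) % p
    head-term = begin
      (a₀ * toℕ (x₀ +𝔽 y₀)) % p
        ≡⟨ %-cong-*ˡ a₀ (trans (cong (_% p) (toℕ-mod _)) (m%n%n≡m%n _ p)) ⟩
      (a₀ * (toℕ x₀ + toℕ y₀)) % p    ≡⟨ cong (_% p) (*-distribˡ-+ a₀ (toℕ x₀) (toℕ y₀)) ⟩
      (a₀ * toℕ x₀ + a₀ * toℕ y₀) % p ∎

  dot-⊕ : ∀ {n} (a x y : Vector 𝔽 n) → dot a (x ⊕ y) ≡ dot a x +𝔽 dot a y
  dot-⊕ a x y = toℕ-injective (begin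
    toℕ (dot a (x ⊕ y))                          ≡⟨ toℕ-dot a (x ⊕ y) ⟩
    dotℕ a (x ⊕ y) % p                           ≡⟨ dotℕ-⊕ a x y ⟩
    (dotℕ a x + dotℕ a y) % p                    ≡⟨ %-distribˡ-+ (dotℕ a x) (dotℕ a y) p ⟩
    (dotℕ a x % p + dotℕ a y % p) % p            ≡⟨ cong₂ (λ s t → (s + t) % p) (toℕ-dot a x) (toℕ-dot a y) ⟨
    (toℕ (dot a x) + toℕ (dot a y)) % p          ≡⟨ toℕ-mod _ ⟨
    toℕ (dot a x +𝔽 dot a y)                     ∎)

  dot-restrictTo : ∀ {n} (a x : Vector 𝔽 n) → dot a (restrictTo a x) ≡ dot a x
  dot-restrictTo a x = toℕ-injective (begin
    toℕ (dot a (restrictTo a x))   ≡⟨ toℕ-dot a _ ⟩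
    dotℕ a (restrictTo a x) % p    ≡⟨ cong (_% p) (dotℕ-restrictTo a x) ⟩
    dotℕ a x % p                   ≡⟨ toℕ-dot a x ⟨
    toℕ (dot a x)                  ∎)

  dot-cong : ∀ {n} (a : Vector 𝔽 n) {x y} → x ≗ y → dot a x ≡ dot a y
  dot-cong {zero}  a x≗y = refl
  dot-cong {suc n} a x≗y =
    cong₂ (λ s t → (head a *𝔽 s) +𝔽 t) (x≗y zero) (dot-cong (tail a) (λ i → x≗y (suc i)))

  dot-shift : ∀ {n} (a d x : Vector 𝔽 n) → dot a d ≡ 0𝔽 →
              dot a (restrictTo a (x ⊕ d)) ≡ dot a x
  dot-shift a d x ad≡0 = begin
    dot a (restrictTo a (x ⊕ d))   ≡⟨ dot-restrictTo a (x ⊕ d) ⟩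
    dot a (x ⊕ d)                  ≡⟨ dot-⊕ a x d ⟩
    dot a x +𝔽 dot a d             ≡⟨ cong (dot a x +𝔽_) ad≡0 ⟩
    dot a x +𝔽 0𝔽                  ≡⟨ +𝔽-identityʳ (dot a x) ⟩
    dot a x                        ∎

  allVecs-complete : ∀ n (x : Vector 𝔽 n) → ∃ λ y → y ∈ allVecs n × y ≗ x
  allVecs-complete zero    x = (λ ()) , here refl , λ ()
  allVecs-complete (suc n) x with allVecs-complete n (tail x)
  ... | y , y∈ , y≗ =
    head x ∷ y ,
    ∈-concatMap⁺ (λ k → map (k ∷_) (allVecs n)) (lose (∈-allFin (head x)) (∈-map⁺ (head x ∷_) y∈)) ,
    λ { zero → refl ; (suc i) → y≗ i }

  ≡⇒≈C : ∀ {n} {C D : Clause n} → C ≡ D → C ≈C D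
  ≡⇒≈C C≡D l = mk⇔ (subst (l ∈_) C≡D) (subst (l ∈_) (sym C≡D))

  ≈F-concatMap : ∀ {n} {X : Set} (G H : X → CNF n) (js : List X) →
                 (∀ j → G j ≈F H j) → concatMap G js ≈F concatMap H js
  ≈F-concatMap G H js G≈H =
    (λ C C∈ → let j , j∈ , C∈G = find (∈-concatMap⁻ G {xs = js} C∈)
                  D , D∈ , C≈D = proj₁ (G≈H j) C C∈G
              in D , ∈-concatMap⁺ H (lose j∈ D∈) , C≈D) ,
    (λ D D∈ → let j , j∈ , D∈H = find (∈-concatMap⁻ H {xs = js} D∈)
                  C , C∈ , C≈D = proj₂ (G≈H j) D D∈H
              in C , ∈-concatMap⁺ G (lose j∈ C∈) , C≈D)

  module Row {n : ℕ} (a : Vector 𝔽 n) (b : 𝔽) where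

    ∈P⁻ : ∀ {x} → x ∈ P a b → ¬ dot a x ≡ b × x ⊆supp a
    ∈P⁻ x∈ = proj₂ (∈-filter⁻ _ {xs = allVecs n} x∈)

    P-complete : ∀ x → ¬ dot a x ≡ b → x ⊆supp a → ∃ λ y → y ∈ P a b × y ≗ x
    P-complete x ax≢b x⊆a with allVecs-complete n x
    ... | y , y∈ , y≗x =
      y , ∈-filter⁺ _ y∈ ((λ ay≡b → ax≢b (trans (dot-cong a (λ i → sym (y≗x i))) ay≡b)) ,
                          (λ i yi≢0 → x⊆a i (λ xi≡0 → yi≢0 (trans (y≗x i) xi≡0)))) ,
      y≗x

    Ca-cong : ∀ {x y} → AgreeOnSupp a x y → Ca a x ≡ Ca a y
    Ca-cong x≐y = map-cong-local (tabulate λ {i} i∈ →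
      cong (λ v → neg (i , v)) (x≐y i (proj₂ (∈-filter⁻ (λ j → ¬? (a j ≟ 0𝔽)) {xs = allFin n} i∈))))

    Δ-Ca : ∀ d {y x} → AgreeOnSupp a (y ⊕ d) x → renClause (Δ d) (Ca a y) ≡ Ca a x
    Δ-Ca d y+d≐x = trans (sym (map-∘ _)) (Ca-cong y+d≐x)

    module _ (d : Vector 𝔽 n) (ad≡0 : dot a d ≡ 0𝔽) where

      translate-P : ∀ {x} → x ∈ P a b → ∃ λ z → z ∈ P a b × AgreeOnSupp a (x ⊕ d) z
      translate-P {x} x∈ with ∈P⁻ x∈
      ... | ax≢b , _ with P-complete (restrictTo a (x ⊕ d))
                            (λ e → ax≢b (trans (sym (dot-shift a d x ad≡0)) e))
                            (restrictTo-⊆supp a (x ⊕ d))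
      ... | z , z∈ , z≗ = z , z∈ , λ i ai≢0 → sym (trans (z≗ i) (restrictTo-inside a (x ⊕ d) i ai≢0))

      untranslate : Vector 𝔽 n → Vector 𝔽 n
      untranslate x = restrictTo a (x ⊖ d)

      untranslate-+d : ∀ x → AgreeOnSupp a (untranslate x ⊕ d) x
      untranslate-+d x i ai≢0 =
        trans (cong (_+𝔽 d i) (restrictTo-inside a (x ⊖ d) i ai≢0)) (-𝔽-+𝔽-cancel (x i) (d i))

      dot-untranslate : ∀ {x} → x ⊆supp a → dot a (untranslate x) ≡ dot a x
      dot-untranslate {x} x⊆a =
        trans (sym (dot-shift a d (untranslate x) ad≡0))
              (dot-cong a (restrictTo-agree a x⊆a (untranslate-+d x)))

      untranslate-P : ∀ {x} → x ∈ P a b → ∃ λ y → y ∈ P a b × AgreeOnSupp a (y ⊕ d) x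
      untranslate-P {x} x∈ with ∈P⁻ x∈
      ... | ax≢b , x⊆a with P-complete (untranslate x)
                              (λ e → ax≢b (trans (sym (dot-untranslate x⊆a)) e))
                              (restrictTo-⊆supp a _)
      ... | y , y∈ , y≗ = y , y∈ , λ i ai≢0 → trans (cong (_+𝔽 d i) (y≗ i)) (untranslate-+d x i ai≢0)

      Δ-preserves-Fab : renCNF (Δ d) (Fab a b) ≈F Fab a b
      Δ-preserves-Fab = forward , backward
        where
        forward : ∀ C → C ∈ renCNF (Δ d) (Fab a b) → ∃ λ D → D ∈ Fab a b × C ≈C D
        forward C C∈ with ∈-map⁻ (renClause (Δ d)) C∈
        ... | C′ , C′∈ , refl with ∈-map⁻ (Ca a) C′∈
        ... | x , x∈ , refl with translate-P x∈
        ... | z , z∈ , x+d≐z = Ca a z , ∈-map⁺ (Ca a) z∈ , ≡⇒≈C (Δ-Ca d x+d≐z)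

        backward : ∀ D → D ∈ Fab a b → ∃ λ C → C ∈ renCNF (Δ d) (Fab a b) × C ≈C D
        backward D D∈ with ∈-map⁻ (Ca a) D∈
        ... | x , x∈ , refl with untranslate-P x∈
        ... | y , y∈ , y+d≐x =
          renClause (Δ d) (Ca a y) , ∈-map⁺ (renClause (Δ d)) (∈-map⁺ (Ca a) y∈) ,
          ≡⇒≈C (Δ-Ca d y+d≐x)

  Δ-bijective : ∀ {n} (d : Vector 𝔽 n) → Bijective _≡_ _≡_ (Δ d)
  Δ-bijective d = injective , surjective
    where
    injective : ∀ {u v} → Δ d u ≡ Δ d v → u ≡ v
    injective {i , k} {j , k′} Δu≡Δv with cong proj₁ Δu≡Δv
    ... | refl = cong (i ,_) (begin
      k                    ≡⟨ +𝔽--𝔽-cancel k (d i) ⟨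
      (k +𝔽 d i) -𝔽 d i    ≡⟨ cong (λ t → t -𝔽 d i) (cong proj₂ Δu≡Δv) ⟩
      (k′ +𝔽 d i) -𝔽 d i   ≡⟨ +𝔽--𝔽-cancel k′ (d i) ⟩
      k′                   ∎)
    surjective : ∀ v → ∃ λ u → ∀ {w} → w ≡ u → Δ d w ≡ v
    surjective (i , k) = (i , k -𝔽 d i) , λ { refl → cong (i ,_) (-𝔽-+𝔽-cancel k (d i)) }

  Δ-symmetry : ∀ m n (A : Fin m → Fin n → 𝔽) (b : Fin m → 𝔽) (d : Fin n → 𝔽) →
               (∀ j → matVec A d j ≡ 0𝔽) → Δ d ∈Sym FAb A b
  Δ-symmetry m n A b d Ad≡0 =
    Δ-bijective d ,
    subst (_≈F FAb A b) (sym (map-concatMap (renClause (Δ d)) _ (allFin m)))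
      (≈F-concatMap _ _ (allFin m) (λ j → Row.Δ-preserves-Fab (A j) (b j) d (Ad≡0 j)))

corollary4p4 : (p : ℕ) (pp : Prime p) (m n : ℕ) →
    let open FpCNF p {{prime⇒nonZero pp}} in
    (A : Fin m → Fin n → 𝔽) (b : Fin m → 𝔽) (d : Fin n → 𝔽) →
    (∀ j → matVec A d j ≡ 0𝔽) →
    Δ d ∈Sym FAb A b
corollary4p4 p pp = ShiftSymmetry.Δ-symmetry p {{prime⇒nonZero pp}}
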